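{- Let $d\ge 2$ be an integer. Two collectors independently draw coupons, each draw being independently and uniformly distributed over $d$ coupon types. For one collector, let $p(n,d)$ be the probability that the collector's collection (at least one coupon of each of the $d$ types) is completed for the first time at exactly the $n$-th draw. Then the probability that both collectors complete their collections for the first time at the same draw satisfies \[\sum_{n\ge 0}p(n,d)^2=\frac{d!^2}{d^{2d}}\sum_{r=1}^{d-1}\sum_{s=1}^{d-1}\frac{A_{d-1,r}A_{d-1,s}}{1-\frac{rs}{d^2}},\qquad\text{where } A_{k,r}=\frac{(-1)^{k-r}r^k}{k!}\binom{k}{r}.\]
   Context: Draws are with replacement; $p(n,d)=\frac{d!}{d^n}{n-1\brace d-1}$, where ${n\brace k}$ denotes Stirling numbers of the second kind. -}

module Defs where

open import Data.Nat as ℕ using (ℕ; zero; suc; _∸_; _!)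
open import Data.Nat.Combinatorics using (_C_)
open import Data.Integer as ℤ using (ℤ; +_)
open import Data.Rational
  using (ℚ; 0ℚ; 1ℚ; _+_; _*_; _-_; -_; _/_; 1/_; _≟_; ≢-nonZero; _<_; ∣_∣)
open import Data.Product using (Σ)
open import Relation.Nullary using (yes; no)

stirling2 : ℕ → ℕ → ℕ
stirling2 zero    zero    = 1
stirling2 zero    (suc k) = 0
stirling2 (suc n) zero    = 0
stirling2 (suc n) (suc k) = suc k ℕ.* stirling2 n (suc k) ℕ.+ stirling2 n k

-- natural-number fraction a / b as a rational (b = 0 never occurs below;
-- the value 0 in that case is an arbitrary totalising convention)
fracℕ : ℕ → ℕ → ℚ
fracℕ a zero    = 0ℚ
fracℕ a (suc b) = (+ a) / suc b

-- multiplicative inverse in ℚ (applied only to nonzero arguments below;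
-- the value 0 at 0 is an arbitrary totalising convention)
inv : ℚ → ℚ
inv q with q ≟ 0ℚ
... | yes _ = 0ℚ
... | no q≢0 = 1/_ q {{≢-nonZero q≢0}}

neg1pow : ℕ → ℚ
neg1pow zero    = 1ℚ
neg1pow (suc n) = - neg1pow n

sum1to : ℕ → (ℕ → ℚ) → ℚ
sum1to zero    f = 0ℚ
sum1to (suc k) f = sum1to k f + f (suc k)

sum0to : ℕ → (ℕ → ℚ) → ℚ
sum0to zero    f = f 0
sum0to (suc N) f = sum0to N f + f (suc N)

p : ℕ → ℕ → ℚ
p zero    d = 0ℚ
p (suc m) d = fracℕ (d ! ℕ.* stirling2 m (d ∸ 1)) (d ℕ.^ suc m)

A : ℕ → ℕ → ℚ
A k r = neg1pow (k ∸ r) * fracℕ (r ℕ.^ k) (k !) * (+ (k C r) / 1)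

rhs : ℕ → ℚ
rhs d =
  fracℕ (d ! ℕ.* d !) (d ℕ.^ (2 ℕ.* d)) *
  sum1to (d ∸ 1) (λ r → sum1to (d ∸ 1) (λ s →
    A (d ∸ 1) r * A (d ∸ 1) s
      * inv (1ℚ - fracℕ (r ℕ.* s) (d ℕ.* d))))

ConvergesTo : (ℕ → ℚ) → ℚ → Set
ConvergesTo a L =
  ∀ (ε : ℚ) → 0ℚ < ε →
    Σ ℕ λ N → ∀ M → N ℕ.≤ M → ∣ a M - L ∣ < ε

{-# OPTIONS --safe #-}
-- Stirling's explicit formula k! S(m,k) = Σ_{r=0}^{k} (-1)^(k-r) C(k,r) r^m writes p(n+1,d), for
-- n ≥ 1, as a finite sum of geometric sequences Σ_{r=1}^{d-1} a_r (r/d)^n with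
-- a_r = (-1)^(d-1-r) C(d-1,r) (the r = 0 term drops out because 0^n = 0). Squaring,
-- p(n+1,d)² = Σ_{r,s} a_r a_s (rs/d²)^n, so the tail
--   T(N) = Σ_{r,s} a_r (r/d)^N · a_s (s/d)^N / (1 - rs/d²)
-- satisfies T(N) = p(N+1,d)² + T(N+1) for N ≥ 1. As p(n,d) = 0 for n < d, the partial sums
-- satisfy S(N) + T(N) = T(d-1) for N ≥ d-1, and T(d-1) is the right-hand side because
-- (d!/d^d) A_{d-1,r} = a_r (r/d)^(d-1). Finally |T(N)| ≤ B ((d-1)/d)^N, which tends to 0 by
-- Bernoulli's inequality.
module Submission where

open import Defs
open import Data.Nat using (ℕ; _≤_)
open import Data.Rational using (_*_)

open import Algebra.Bundles using (CommutativeRing)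
import Algebra.Properties.CommutativeSemigroup as CommSemigroupProperties
open import Data.Integer.Base as ℤ using (+0; +[1+_]; -[1+_])
import Data.Integer.Properties as ℤ
open import Data.Nat.Base as ℕ using (zero; suc; NonZero; _!; _∸_; z≤n; s≤s)
import Data.Nat.Properties as ℕ
import Data.Nat.Tactic.RingSolver as ℕ
open import Data.Nat.Combinatorics using (_C_; nCk+nC[k+1]≡[n+1]C[k+1]; k>n⇒nCk≡0; nC1≡n)
open import Data.Product.Base using (Σ; _,_; proj₁; proj₂)
open import Data.Rational.Base as ℚ
  using (ℚ; 0ℚ; 1ℚ; _+_; _-_; -_; ∣_∣; mkℚ; ≢-nonZero; toℚᵘ; fromℚᵘ)
import Data.Rational.Properties as ℚ
open import Data.Rational.Unnormalised.Base as ℚᵘ using (mkℚᵘ; _≃_; *≡*; *≤*; *<*)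
import Data.Rational.Unnormalised.Properties as ℚᵘ
open import Level using (0ℓ)
open import Relation.Binary.PropositionalEquality
open import Relation.Nullary using (yes; no; contradiction)
open import Relation.Nullary.Decidable using (dec⇒maybe)
open import Tactic.RingSolver using (solve-∀)
open import Tactic.RingSolver.Core.AlmostCommutativeRing
  using (AlmostCommutativeRing; fromCommutativeRing)

ℚ-ring : AlmostCommutativeRing 0ℓ 0ℓ
ℚ-ring = fromCommutativeRing ℚ.+-*-commutativeRing (λ q → dec⇒maybe (0ℚ ℚ.≟ q))

open import Algebra.Properties.CommutativeSemiring.Exp
  (CommutativeRing.commutativeSemiring ℚ.+-*-commutativeRing) using (_^_; ^-distrib-*)

module ℕ-* = CommSemigroupProperties ℕ.*-commutativeSemigroup
module ℚ-+ = CommSemigroupProperties (CommutativeRing.+-commutativeSemigroup ℚ.+-*-commutativeRing)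
module ℚ-* = CommSemigroupProperties (CommutativeRing.*-commutativeSemigroup ℚ.+-*-commutativeRing)

fromℕ : ℕ → ℚ
fromℕ n = fracℕ n 1

toℚᵘ-fracℕ : ∀ a b .{{_ : NonZero b}} → toℚᵘ (fracℕ a b) ≃ mkℚᵘ (ℤ.+ a) (ℕ.pred b)
toℚᵘ-fracℕ a (suc b) = ℚ.toℚᵘ-fromℚᵘ (mkℚᵘ (ℤ.+ a) b)

fracℕ-*≡* : ∀ a b c e .{{_ : NonZero b}} .{{_ : NonZero e}} →
            a ℕ.* e ≡ c ℕ.* b → fracℕ a b ≡ fracℕ c e
fracℕ-*≡* a (suc b) c (suc e) ae≡cb = ℚ.toℚᵘ-injective (ℚᵘ.≃-trans (toℚᵘ-fracℕ a (suc b))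
  (ℚᵘ.≃-trans (*≡* (trans (sym (ℤ.pos-* a (suc e))) (trans (cong ℤ.+_ ae≡cb) (ℤ.pos-* c (suc b)))))
    (ℚᵘ.≃-sym (toℚᵘ-fracℕ c (suc e)))))

fracℕ-*≤* : ∀ a b c e .{{_ : NonZero b}} .{{_ : NonZero e}} →
            a ℕ.* e ℕ.≤ c ℕ.* b → fracℕ a b ℚ.≤ fracℕ c e
fracℕ-*≤* a (suc b) c (suc e) ae≤cb = ℚ.toℚᵘ-cancel-≤
  (ℚᵘ.≤-respˡ-≃ (ℚᵘ.≃-sym (toℚᵘ-fracℕ a (suc b)))
  (ℚᵘ.≤-respʳ-≃ (ℚᵘ.≃-sym (toℚᵘ-fracℕ c (suc e)))
    (*≤* (subst₂ ℤ._≤_ (ℤ.pos-* a (suc e)) (ℤ.pos-* c (suc b)) (ℤ.+≤+ ae≤cb)))))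

fracℕ-*<* : ∀ a b c e .{{_ : NonZero b}} .{{_ : NonZero e}} →
            a ℕ.* e ℕ.< c ℕ.* b → fracℕ a b ℚ.< fracℕ c e
fracℕ-*<* a (suc b) c (suc e) ae<cb = ℚ.toℚᵘ-cancel-<
  (ℚᵘ.<-respˡ-≃ (ℚᵘ.≃-sym (toℚᵘ-fracℕ a (suc b)))
  (ℚᵘ.<-respʳ-≃ (ℚᵘ.≃-sym (toℚᵘ-fracℕ c (suc e)))
    (*<* (subst₂ ℤ._<_ (ℤ.pos-* a (suc e)) (ℤ.pos-* c (suc b)) (ℤ.+<+ ae<cb)))))

fracℕ-nonNeg : ∀ a b → 0ℚ ℚ.≤ fracℕ a b
fracℕ-nonNeg a zero    = ℚ.≤-refl
fracℕ-nonNeg a (suc b) = fracℕ-*≤* 0 1 a (suc b) z≤n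

fracℕ-zero : ∀ b → fracℕ 0 b ≡ 0ℚ
fracℕ-zero zero    = refl
fracℕ-zero (suc b) = ℚ.0/n≡0 (suc b)

fracℕ-* : ∀ a b c e .{{_ : NonZero b}} .{{_ : NonZero e}} →
          fracℕ a b * fracℕ c e ≡ fracℕ (a ℕ.* c) (b ℕ.* e)
fracℕ-* a (suc b) c (suc e) = begin
  fracℕ a (suc b) * fracℕ c (suc e)
    ≡⟨ ℚ.fromℚᵘ-toℚᵘ _ ⟨
  fromℚᵘ (toℚᵘ (fracℕ a (suc b) * fracℕ c (suc e)))
    ≡⟨ ℚ.fromℚᵘ-cong (ℚᵘ.≃-trans (ℚ.toℚᵘ-homo-* (fracℕ a (suc b)) (fracℕ c (suc e)))
         (ℚᵘ.*-cong (toℚᵘ-fracℕ a (suc b)) (toℚᵘ-fracℕ c (suc e)))) ⟩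
  fromℚᵘ (mkℚᵘ (ℤ.+ a) b ℚᵘ.* mkℚᵘ (ℤ.+ c) e)
    ≡⟨ ℚ./-cong (sym (ℤ.pos-* a c)) refl ⟩
  fracℕ (a ℕ.* c) (suc b ℕ.* suc e) ∎
  where open ≡-Reasoning

fromℕ-* : ∀ m n → fromℕ (m ℕ.* n) ≡ fromℕ m * fromℕ n
fromℕ-* m n = sym (fracℕ-* m 1 n 1)

fromℕ-+ : ∀ m n → fromℕ (m ℕ.+ n) ≡ fromℕ m + fromℕ n
fromℕ-+ m n = begin
  fromℕ (m ℕ.+ n)
    ≡⟨ ℚ./-cong (trans (ℤ.pos-+ m n)
         (sym (cong₂ ℤ._+_ (ℤ.*-identityʳ (ℤ.+ m)) (ℤ.*-identityʳ (ℤ.+ n))))) refl ⟩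
  fromℚᵘ (mkℚᵘ (ℤ.+ m) 0 ℚᵘ.+ mkℚᵘ (ℤ.+ n) 0)
    ≡⟨ ℚ.fromℚᵘ-cong (ℚᵘ.≃-sym (ℚᵘ.≃-trans (ℚ.toℚᵘ-homo-+ (fromℕ m) (fromℕ n))
         (ℚᵘ.+-cong (toℚᵘ-fracℕ m 1) (toℚᵘ-fracℕ n 1)))) ⟩
  fromℚᵘ (toℚᵘ (fromℕ m + fromℕ n))
    ≡⟨ ℚ.fromℚᵘ-toℚᵘ _ ⟩
  fromℕ m + fromℕ n ∎
  where open ≡-Reasoning

fracℕ-^ : ∀ a b n .{{_ : NonZero b}} → fracℕ a b ^ n ≡ fracℕ (a ℕ.^ n) (b ℕ.^ n)
fracℕ-^ a b zero    = refl
fracℕ-^ a b (suc n) = trans (cong (fracℕ a b *_) (fracℕ-^ a b n)) (fracℕ-* a b (a ℕ.^ n) (b ℕ.^ n))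
  where instance _ = ℕ.m^n≢0 b n

fromℕ-*-fracℕ : ∀ a c e .{{_ : NonZero e}} → fromℕ a * fracℕ c e ≡ fracℕ (a ℕ.* c) e
fromℕ-*-fracℕ a c e = trans (fracℕ-* a 1 c e)
  (fracℕ-*≡* (a ℕ.* c) (1 ℕ.* e) (a ℕ.* c) e (cong (a ℕ.* c ℕ.*_) (sym (ℕ.*-identityˡ e))))
  where instance _ = ℕ.m*n≢0 1 e

fracℕ≡fromℕ*1/ : ∀ a b .{{_ : NonZero b}} → fracℕ a b ≡ fromℕ a * fracℕ 1 b
fracℕ≡fromℕ*1/ a b = sym (trans (fromℕ-*-fracℕ a 1 b) (cong (λ c → fracℕ c b) (ℕ.*-identityʳ a)))

fracℕ-cancelˡ : ∀ c a b .{{_ : NonZero c}} .{{_ : NonZero b}} → fracℕ (c ℕ.* a) (c ℕ.* b) ≡ fracℕ a b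
fracℕ-cancelˡ c a b = fracℕ-*≡* (c ℕ.* a) (c ℕ.* b) a b (trans (ℕ.*-assoc c a b) (ℕ-*.x∙yz≈y∙xz c a b))
  where instance _ = ℕ.m*n≢0 c b

*-inv : ∀ q → q ≢ 0ℚ → q * inv q ≡ 1ℚ
*-inv q q≢0 with q ℚ.≟ 0ℚ
... | yes q≡0 = contradiction q≡0 q≢0
... | no  q≢0 = ℚ.*-inverseʳ q {{≢-nonZero q≢0}}

[1-x]*inv[1-x]≡1 : ∀ {x} → x ℚ.< 1ℚ → (1ℚ - x) * inv (1ℚ - x) ≡ 1ℚ
[1-x]*inv[1-x]≡1 {x} x<1 = *-inv (1ℚ - x) λ 1-x≡0 →
  ℚ.<-irrefl (trans (x≡1-[1-x] x) (cong (λ z → 1ℚ - z) 1-x≡0)) x<1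
  where
  x≡1-[1-x] : ∀ x → x ≡ 1ℚ - (1ℚ - x)
  x≡1-[1-x] = solve-∀ ℚ-ring

geometric-step : ∀ {x i} → (1ℚ - x) * i ≡ 1ℚ → ∀ b → b * i ≡ b + b * x * i
geometric-step {x} {i} [1-x]i≡1 b = begin
  b * i                           ≡⟨ split b x i ⟩
  b * ((1ℚ - x) * i) + b * x * i  ≡⟨ cong (λ c → b * c + b * x * i) [1-x]i≡1 ⟩
  b * 1ℚ + b * x * i              ≡⟨ cong (_+ b * x * i) (ℚ.*-identityʳ b) ⟩
  b + b * x * i                   ∎
  where
  open ≡-Reasoning
  split : ∀ b x i → b * i ≡ b * ((1ℚ - x) * i) + b * x * i
  split = solve-∀ ℚ-ring

module _ {f g : ℕ → ℚ} where

  sum0to-cong : ∀ k → (∀ r → r ℕ.≤ k → f r ≡ g r) → sum0to k f ≡ sum0to k g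
  sum0to-cong zero    f≡g = f≡g 0 z≤n
  sum0to-cong (suc k) f≡g =
    cong₂ _+_ (sum0to-cong k (λ r r≤k → f≡g r (ℕ.m≤n⇒m≤1+n r≤k))) (f≡g (suc k) ℕ.≤-refl)

  sum1to-cong : ∀ k → (∀ r → r ℕ.≤ k → f r ≡ g r) → sum1to k f ≡ sum1to k g
  sum1to-cong zero    f≡g = refl
  sum1to-cong (suc k) f≡g =
    cong₂ _+_ (sum1to-cong k (λ r r≤k → f≡g r (ℕ.m≤n⇒m≤1+n r≤k))) (f≡g (suc k) ℕ.≤-refl)

  sum0to-distrib-+ : ∀ k → sum0to k (λ r → f r + g r) ≡ sum0to k f + sum0to k g
  sum0to-distrib-+ zero    = refl
  sum0to-distrib-+ (suc k) = trans (cong (_+ (f (suc k) + g (suc k))) (sum0to-distrib-+ k))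
    (ℚ-+.interchange (sum0to k f) (sum0to k g) (f (suc k)) (g (suc k)))

  sum1to-distrib-+ : ∀ k → sum1to k (λ r → f r + g r) ≡ sum1to k f + sum1to k g
  sum1to-distrib-+ zero    = refl
  sum1to-distrib-+ (suc k) = trans (cong (_+ (f (suc k) + g (suc k))) (sum1to-distrib-+ k))
    (ℚ-+.interchange (sum1to k f) (sum1to k g) (f (suc k)) (g (suc k)))

  ∣sum1to∣≤sum1to : ∀ k → (∀ r → r ℕ.≤ k → ∣ f r ∣ ℚ.≤ g r) →
                    ∣ sum1to k f ∣ ℚ.≤ sum1to k g
  ∣sum1to∣≤sum1to zero    _     = ℚ.≤-refl
  ∣sum1to∣≤sum1to (suc k) ∣f∣≤g = ℚ.≤-trans (ℚ.∣p+q∣≤∣p∣+∣q∣ (sum1to k f) (f (suc k)))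
    (ℚ.+-mono-≤ (∣sum1to∣≤sum1to k (λ r r≤k → ∣f∣≤g r (ℕ.m≤n⇒m≤1+n r≤k)))
                (∣f∣≤g (suc k) ℕ.≤-refl))

module _ (f : ℕ → ℚ) where

  *-distribˡ-sum0to : ∀ c k → c * sum0to k f ≡ sum0to k (λ r → c * f r)
  *-distribˡ-sum0to c zero    = refl
  *-distribˡ-sum0to c (suc k) =
    trans (ℚ.*-distribˡ-+ c (sum0to k f) (f (suc k))) (cong (_+ c * f (suc k)) (*-distribˡ-sum0to c k))

  *-distribˡ-sum1to : ∀ c k → c * sum1to k f ≡ sum1to k (λ r → c * f r)
  *-distribˡ-sum1to c zero    = ℚ.*-zeroʳ c
  *-distribˡ-sum1to c (suc k) =
    trans (ℚ.*-distribˡ-+ c (sum1to k f) (f (suc k))) (cong (_+ c * f (suc k)) (*-distribˡ-sum1to c k))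

  *-distribʳ-sum1to : ∀ c k → sum1to k f * c ≡ sum1to k (λ r → f r * c)
  *-distribʳ-sum1to c k = trans (ℚ.*-comm (sum1to k f) c)
    (trans (*-distribˡ-sum1to c k) (sum1to-cong k (λ r _ → ℚ.*-comm c (f r))))

  sum0to-suc : ∀ k → sum0to (suc k) f ≡ f 0 + sum0to k (λ r → f (suc r))
  sum0to-suc zero    = refl
  sum0to-suc (suc k) = trans (cong (_+ f (suc (suc k))) (sum0to-suc k)) (ℚ.+-assoc (f 0) _ _)

  sum0to≡f0+sum1to : ∀ k → sum0to k f ≡ f 0 + sum1to k f
  sum0to≡f0+sum1to zero    = sym (ℚ.+-identityʳ (f 0))
  sum0to≡f0+sum1to (suc k) = trans (cong (_+ f (suc k)) (sum0to≡f0+sum1to k)) (ℚ.+-assoc (f 0) _ _)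

  sum0to-telescope : ∀ k → sum0to k (λ r → f r - f (suc r)) ≡ f 0 - f (suc k)
  sum0to-telescope zero    = refl
  sum0to-telescope (suc k) = trans (cong (_+ (f (suc k) - f (suc (suc k)))) (sum0to-telescope k))
    (cancel (f 0) (f (suc k)) (f (suc (suc k))))
    where
    cancel : ∀ x y z → (x - y) + (y - z) ≡ x - z
    cancel = solve-∀ ℚ-ring

sum1to-*-sum1to : ∀ k l (f g : ℕ → ℚ) →
                  sum1to k f * sum1to l g ≡ sum1to k (λ r → sum1to l (λ s → f r * g s))
sum1to-*-sum1to k l f g = trans (*-distribʳ-sum1to f (sum1to l g) k)
  (sum1to-cong k (λ r _ → *-distribˡ-sum1to g (f r) l))

sum0to+tail-invariant : ∀ {b t : ℕ → ℚ} {N₀} → (∀ N → N₀ ℕ.≤ N → t N ≡ b (suc N) + t (suc N)) →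
                        ∀ M → N₀ ℕ.≤ M → sum0to M b + t M ≡ sum0to N₀ b + t N₀
sum0to+tail-invariant {b} {t} {N₀} step M N₀≤M = go (ℕ.≤⇒≤′ N₀≤M)
  where
  go : ∀ {M} → N₀ ℕ.≤′ M → sum0to M b + t M ≡ sum0to N₀ b + t N₀
  go ℕ.≤′-refl             = refl
  go (ℕ.≤′-step {M} N₀≤′M) = begin
    sum0to M b + b (suc M) + t (suc M)   ≡⟨ ℚ.+-assoc (sum0to M b) (b (suc M)) (t (suc M)) ⟩
    sum0to M b + (b (suc M) + t (suc M)) ≡⟨ cong (sum0to M b +_) (step M (ℕ.≤′⇒≤ N₀≤′M)) ⟨
    sum0to M b + t M                     ≡⟨ go N₀≤′M ⟩
    sum0to N₀ b + t N₀                   ∎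
    where open ≡-Reasoning

^-nonNeg : ∀ {x} n → 0ℚ ℚ.≤ x → 0ℚ ℚ.≤ x ^ n
^-nonNeg         zero    _   = fracℕ-nonNeg 1 1
^-nonNeg {x = x} (suc n) 0≤x = ℚ.nonNegative⁻¹ (x * x ^ n)
  {{ℚ.nonNeg*nonNeg⇒nonNeg x {{ℚ.nonNegative 0≤x}} (x ^ n) {{ℚ.nonNegative (^-nonNeg n 0≤x)}}}}

^-mono-≤ : ∀ {x y} n → 0ℚ ℚ.≤ x → x ℚ.≤ y → x ^ n ℚ.≤ y ^ n
^-mono-≤         zero    _   _   = ℚ.≤-refl
^-mono-≤ {x} {y} (suc n) 0≤x x≤y = ℚ.≤-trans
  (ℚ.*-monoʳ-≤-nonNeg (x ^ n) {{ℚ.nonNegative (^-nonNeg n 0≤x)}} x≤y)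
  (ℚ.*-monoˡ-≤-nonNeg y {{ℚ.nonNegative (ℚ.≤-trans 0≤x x≤y)}} (^-mono-≤ n 0≤x x≤y))

-- Bernoulli's inequality (1 + 1/p)ⁿ ≥ 1 + n/p with denominators cleared, and 1 + p relaxed to 1 + q.
bernoulli : ∀ {p q} → p ℕ.≤ q → ∀ n → p ℕ.^ n ℕ.* (p ℕ.+ n) ℕ.≤ p ℕ.* suc q ℕ.^ n
bernoulli {p} p≤q zero    =
  ℕ.≤-reflexive (trans (ℕ.*-identityˡ (p ℕ.+ 0)) (trans (ℕ.+-identityʳ p) (sym (ℕ.*-identityʳ p))))
bernoulli {p} {q} p≤q (suc n) = begin
  p ℕ.* P ℕ.* (p ℕ.+ suc n)            ≡⟨ expand p P n ⟩
  P ℕ.* p ℕ.+ p ℕ.* (P ℕ.* (p ℕ.+ n))  ≤⟨ ℕ.+-monoˡ-≤ _ (ℕ.*-monoʳ-≤ P (ℕ.m≤m+n p n)) ⟩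
  suc p ℕ.* (P ℕ.* (p ℕ.+ n))          ≤⟨ ℕ.*-mono-≤ (s≤s p≤q) (bernoulli p≤q n) ⟩
  suc q ℕ.* (p ℕ.* suc q ℕ.^ n)        ≡⟨ ℕ-*.x∙yz≈y∙xz (suc q) p (suc q ℕ.^ n) ⟩
  p ℕ.* suc q ℕ.^ suc n                ∎
  where
  open ℕ.≤-Reasoning
  P : ℕ
  P = p ℕ.^ n
  expand : ∀ p P n → p ℕ.* P ℕ.* (p ℕ.+ suc n) ≡ P ℕ.* p ℕ.+ p ℕ.* (P ℕ.* (p ℕ.+ n))
  expand = ℕ.solve-∀

fracℕ-^-bernoulli : ∀ {p q} → p ℕ.≤ q → ∀ n → fracℕ p (suc q) ^ suc n ℚ.≤ fracℕ p (suc (p ℕ.+ n))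
fracℕ-^-bernoulli {p} {q} p≤q n = subst (ℚ._≤ fracℕ p (suc (p ℕ.+ n))) (sym (fracℕ-^ p (suc q) (suc n)))
  (fracℕ-*≤* (p ℕ.^ suc n) (suc q ℕ.^ suc n) p (suc (p ℕ.+ n))
    (subst (λ m → p ℕ.^ suc n ℕ.* m ℕ.≤ p ℕ.* suc q ℕ.^ suc n) (ℕ.+-suc p n) (bernoulli p≤q (suc n))))
  where instance _ = ℕ.m^n≢0 (suc q) (suc n)

archimedean : ∀ q → Σ ℕ (λ U → q ℚ.≤ fromℕ U)
archimedean q@(mkℚ (ℤ.+ n) e _) =
  n , subst (ℚ._≤ fromℕ n) (ℚ.↥p/↧p≡p q) (fracℕ-*≤* n (suc e) n 1 (ℕ.*-monoʳ-≤ n (s≤s z≤n)))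
archimedean q@(mkℚ -[1+ n ] e _) = 0 , ℚ.<⇒≤ (ℚ.negative⁻¹ q)

convergesTo-geometric : ∀ {a : ℕ → ℚ} {L} (C : ℚ) (p q N₀ : ℕ) → p ℕ.≤ q →
  (∀ M → N₀ ℕ.≤ M → ∣ a M - L ∣ ℚ.≤ C * fracℕ p (suc q) ^ M) → ConvergesTo a L
convergesTo-geometric C p q N₀ p≤q bound (mkℚ +0 _ _) 0<ε with () ← ℚ.positive 0<ε
convergesTo-geometric C p q N₀ p≤q bound ε@(mkℚ -[1+ _ ] _ _) 0<ε with () ← ℚ.positive 0<ε
convergesTo-geometric {a} {L} C p q N₀ p≤q bound ε@(mkℚ +[1+ n ] e _) _ = suc N , close
  where
  U : ℕ
  U = proj₁ (archimedean C)
  N : ℕ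
  N = N₀ ℕ.+ U ℕ.* p ℕ.* suc e
  Y : ℚ
  Y = fracℕ p (suc q)
  close : ∀ M → suc N ℕ.≤ M → ∣ a M - L ∣ ℚ.< ε
  close (suc M) (s≤s N≤M) = begin-strict
    ∣ a (suc M) - L ∣
      ≤⟨ bound (suc M) (ℕ.m≤n⇒m≤1+n (ℕ.m+n≤o⇒m≤o N₀ N≤M)) ⟩
    C * Y ^ suc M
      ≤⟨ ℚ.*-monoʳ-≤-nonNeg (Y ^ suc M) {{0≤Yᴹ}} (proj₂ (archimedean C)) ⟩
    fromℕ U * Y ^ suc M
      ≤⟨ ℚ.*-monoˡ-≤-nonNeg (fromℕ U) {{0≤U}} (fracℕ-^-bernoulli p≤q M) ⟩
    fromℕ U * fracℕ p (suc (p ℕ.+ M))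
      ≡⟨ fromℕ-*-fracℕ U p (suc (p ℕ.+ M)) ⟩
    fracℕ (U ℕ.* p) (suc (p ℕ.+ M))
      <⟨ fracℕ-*<* (U ℕ.* p) (suc (p ℕ.+ M)) (suc n) (suc e) Up[1+e]<[1+n][1+p+M] ⟩
    fracℕ (suc n) (suc e)
      ≡⟨ ℚ.↥p/↧p≡p ε ⟩
    ε ∎
    where
    open ℚ.≤-Reasoning
    0≤Yᴹ : ℚ.NonNegative (Y ^ suc M)
    0≤Yᴹ = ℚ.nonNegative (^-nonNeg (suc M) (fracℕ-nonNeg p (suc q)))
    0≤U : ℚ.NonNegative (fromℕ U)
    0≤U = ℚ.nonNegative (fracℕ-nonNeg U 1)
    Up[1+e]<[1+n][1+p+M] : U ℕ.* p ℕ.* suc e ℕ.< suc n ℕ.* suc (p ℕ.+ M)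
    Up[1+e]<[1+n][1+p+M] = ℕ.≤-trans (s≤s (ℕ.≤-trans (ℕ.m+n≤o⇒n≤o N₀ N≤M) (ℕ.m≤n+m M p)))
      (ℕ.m≤n*m (suc (p ℕ.+ M)) (suc n))

[n+1]C[k+1]*[k+1]≡[n+1]*nCk : ∀ n k → (suc n C suc k) ℕ.* suc k ≡ suc n ℕ.* (n C k)
[n+1]C[k+1]*[k+1]≡[n+1]*nCk zero    zero    = refl
[n+1]C[k+1]*[k+1]≡[n+1]*nCk zero    (suc k) = refl
[n+1]C[k+1]*[k+1]≡[n+1]*nCk (suc n) zero    = cong (ℕ._* 1) (nC1≡n (suc (suc n)))
[n+1]C[k+1]*[k+1]≡[n+1]*nCk (suc n) (suc k) = begin
  (suc (suc n) C suc (suc k)) ℕ.* suc (suc k)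
    ≡⟨ cong (ℕ._* suc (suc k)) (nCk+nC[k+1]≡[n+1]C[k+1] (suc n) (suc k)) ⟨
  (c ℕ.+ c′) ℕ.* suc (suc k)
    ≡⟨ expand c c′ k ⟩
  c ℕ.* suc k ℕ.+ c ℕ.+ c′ ℕ.* suc (suc k)
    ≡⟨ cong₂ (λ x y → x ℕ.+ c ℕ.+ y) ([n+1]C[k+1]*[k+1]≡[n+1]*nCk n k)
                                      ([n+1]C[k+1]*[k+1]≡[n+1]*nCk n (suc k)) ⟩
  suc n ℕ.* (n C k) ℕ.+ c ℕ.+ suc n ℕ.* (n C suc k)
    ≡⟨ regroup (suc n) (n C k) c (n C suc k) ⟩
  suc n ℕ.* (n C k ℕ.+ n C suc k) ℕ.+ c
    ≡⟨ cong (λ x → suc n ℕ.* x ℕ.+ c) (nCk+nC[k+1]≡[n+1]C[k+1] n k) ⟩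
  suc n ℕ.* c ℕ.+ c
    ≡⟨ ℕ.+-comm (suc n ℕ.* c) c ⟩
  suc (suc n) ℕ.* c ∎
  where
  open ≡-Reasoning
  c c′ : ℕ
  c  = suc n C suc k
  c′ = suc n C suc (suc k)
  expand : ∀ x y k → (x ℕ.+ y) ℕ.* suc (suc k) ≡ x ℕ.* suc k ℕ.+ x ℕ.+ y ℕ.* suc (suc k)
  expand = ℕ.solve-∀
  regroup : ∀ m x a y → m ℕ.* x ℕ.+ a ℕ.+ m ℕ.* y ≡ m ℕ.* (x ℕ.+ y) ℕ.+ a
  regroup = ℕ.solve-∀

neg1pow-∸-suc : ∀ {k r} → r ℕ.< k → neg1pow (k ∸ r) ≡ - neg1pow (k ∸ suc r)
neg1pow-∸-suc {suc k} {zero}  _         = refl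
neg1pow-∸-suc {suc k} {suc r} (s≤s r<k) = neg1pow-∸-suc r<k

signedBinom : ℕ → ℕ → ℚ
signedBinom k r = neg1pow (k ∸ r) * fromℕ (k C r)

k<r⇒signedBinom≡0 : ∀ {k r} → k ℕ.< r → signedBinom k r ≡ 0ℚ
k<r⇒signedBinom≡0 {k} {r} k<r =
  trans (cong (λ c → neg1pow (k ∸ r) * fromℕ c) (k>n⇒nCk≡0 k<r)) (ℚ.*-zeroʳ (neg1pow (k ∸ r)))

signedBinom-pascal : ∀ k r → signedBinom (suc k) (suc r) ≡ signedBinom k r - signedBinom k (suc r)
signedBinom-pascal k r = begin
  σ * fromℕ (suc k C suc r)                 ≡⟨ cong (λ c → σ * fromℕ c) (nCk+nC[k+1]≡[n+1]C[k+1] k r) ⟨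
  σ * fromℕ (k C r ℕ.+ k C suc r)           ≡⟨ cong (σ *_) (fromℕ-+ (k C r) (k C suc r)) ⟩
  σ * (fromℕ (k C r) + fromℕ (k C suc r))   ≡⟨ ℚ.*-distribˡ-+ σ (fromℕ (k C r)) (fromℕ (k C suc r)) ⟩
  signedBinom k r + σ * fromℕ (k C suc r)   ≡⟨ cong (signedBinom k r +_) shift ⟩
  signedBinom k r - signedBinom k (suc r)   ∎
  where
  open ≡-Reasoning
  σ : ℚ
  σ = neg1pow (k ∸ r)
  shift : σ * fromℕ (k C suc r) ≡ - signedBinom k (suc r)
  shift with r ℕ.<? k
  ... | yes r<k = trans (cong (_* fromℕ (k C suc r)) (neg1pow-∸-suc r<k))
                        (sym (ℚ.neg-distribˡ-* (neg1pow (k ∸ suc r)) (fromℕ (k C suc r))))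
  ... | no  r≮k = begin
    σ * fromℕ (k C suc r)       ≡⟨ cong (λ c → σ * fromℕ c) (k>n⇒nCk≡0 k<1+r) ⟩
    σ * 0ℚ                      ≡⟨ ℚ.*-zeroʳ σ ⟩
    - 0ℚ                        ≡⟨ cong -_ (k<r⇒signedBinom≡0 k<1+r) ⟨
    - signedBinom k (suc r)     ∎
    where
    k<1+r : k ℕ.< suc r
    k<1+r = ℕ.≤-<-trans (ℕ.≮⇒≥ r≮k) (ℕ.n<1+n r)

signedBinom-absorb : ∀ k r →
  signedBinom (suc k) r * fromℕ r ≡ fromℕ (suc k) * (signedBinom (suc k) r + signedBinom k r)
signedBinom-absorb k zero    =
  trans (ℚ.*-zeroʳ (signedBinom (suc k) 0)) (sym (cancel (fromℕ (suc k)) (neg1pow k)))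
  where
  cancel : ∀ K σ → K * (- σ * 1ℚ + σ * 1ℚ) ≡ 0ℚ
  cancel = solve-∀ ℚ-ring
signedBinom-absorb k (suc r) = begin
  σ * fromℕ (suc k C suc r) * fromℕ (suc r)     ≡⟨ ℚ.*-assoc σ _ _ ⟩
  σ * (fromℕ (suc k C suc r) * fromℕ (suc r))   ≡⟨ cong (σ *_) (fromℕ-* (suc k C suc r) (suc r)) ⟨
  σ * fromℕ ((suc k C suc r) ℕ.* suc r)         ≡⟨ cong (λ c → σ * fromℕ c) ([n+1]C[k+1]*[k+1]≡[n+1]*nCk k r) ⟩
  σ * fromℕ (suc k ℕ.* (k C r))                 ≡⟨ cong (σ *_) (fromℕ-* (suc k) (k C r)) ⟩
  σ * (fromℕ (suc k) * fromℕ (k C r))           ≡⟨ ℚ-*.x∙yz≈y∙xz σ (fromℕ (suc k)) (fromℕ (k C r)) ⟩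
  fromℕ (suc k) * signedBinom k r
    ≡⟨ cong (fromℕ (suc k) *_) (a-b+b≡a (signedBinom k r) (signedBinom k (suc r))) ⟨
  fromℕ (suc k) * (signedBinom k r - signedBinom k (suc r) + signedBinom k (suc r))
    ≡⟨ cong (λ x → fromℕ (suc k) * (x + signedBinom k (suc r))) (signedBinom-pascal k r) ⟨
  fromℕ (suc k) * (signedBinom (suc k) (suc r) + signedBinom k (suc r)) ∎
  where
  open ≡-Reasoning
  σ : ℚ
  σ = neg1pow (k ∸ r)
  a-b+b≡a : ∀ a b → a - b + b ≡ a
  a-b+b≡a = solve-∀ ℚ-ring

sum0to-signedBinom : ∀ k → sum0to (suc k) (signedBinom (suc k)) ≡ 0ℚ
sum0to-signedBinom k = begin
  sum0to (suc k) (signedBinom (suc k))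
    ≡⟨ sum0to-suc (signedBinom (suc k)) k ⟩
  signedBinom (suc k) 0 + sum0to k (λ r → signedBinom (suc k) (suc r))
    ≡⟨ cong (signedBinom (suc k) 0 +_) (sum0to-cong k (λ r _ → signedBinom-pascal k r)) ⟩
  signedBinom (suc k) 0 + sum0to k (λ r → signedBinom k r - signedBinom k (suc r))
    ≡⟨ cong (signedBinom (suc k) 0 +_) (sum0to-telescope (signedBinom k) k) ⟩
  - neg1pow k * 1ℚ + (neg1pow k * 1ℚ - signedBinom k (suc k))
    ≡⟨ cong (λ x → - neg1pow k * 1ℚ + (neg1pow k * 1ℚ - x)) (k<r⇒signedBinom≡0 (ℕ.n<1+n k)) ⟩
  - neg1pow k * 1ℚ + (neg1pow k * 1ℚ - 0ℚ)
    ≡⟨ cancel (neg1pow k) ⟩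
  0ℚ ∎
  where
  open ≡-Reasoning
  cancel : ∀ σ → - σ * 1ℚ + (σ * 1ℚ - 0ℚ) ≡ 0ℚ
  cancel = solve-∀ ℚ-ring

alternatingPowerSum : ℕ → ℕ → ℚ
alternatingPowerSum k m = sum0to k (λ r → signedBinom k r * fromℕ r ^ m)

alternatingPowerSum-zero : ∀ k → alternatingPowerSum (suc k) 0 ≡ 0ℚ
alternatingPowerSum-zero k =
  trans (sum0to-cong (suc k) (λ r _ → ℚ.*-identityʳ (signedBinom (suc k) r))) (sum0to-signedBinom k)

alternatingPowerSum-suc : ∀ k m → alternatingPowerSum (suc k) (suc m) ≡
  fromℕ (suc k) * (alternatingPowerSum (suc k) m + alternatingPowerSum k m)
alternatingPowerSum-suc k m = begin
  sum0to (suc k) (λ r → signedBinom (suc k) r * (fromℕ r * X r))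
    ≡⟨ sum0to-cong (suc k) (λ r _ → term r) ⟩
  sum0to (suc k) (λ r → K * (signedBinom (suc k) r * X r + signedBinom k r * X r))
    ≡⟨ *-distribˡ-sum0to _ K (suc k) ⟨
  K * sum0to (suc k) (λ r → signedBinom (suc k) r * X r + signedBinom k r * X r)
    ≡⟨ cong (K *_) (sum0to-distrib-+ (suc k)) ⟩
  K * (alternatingPowerSum (suc k) m + (alternatingPowerSum k m + signedBinom k (suc k) * X (suc k)))
    ≡⟨ cong (λ x → K * (alternatingPowerSum (suc k) m + (alternatingPowerSum k m + x * X (suc k))))
            (k<r⇒signedBinom≡0 (ℕ.n<1+n k)) ⟩
  K * (alternatingPowerSum (suc k) m + (alternatingPowerSum k m + 0ℚ * X (suc k)))
    ≡⟨ cong (λ x → K * (alternatingPowerSum (suc k) m + x)) (drop-zero (alternatingPowerSum k m) (X (suc k))) ⟩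
  K * (alternatingPowerSum (suc k) m + alternatingPowerSum k m) ∎
  where
  open ≡-Reasoning
  K : ℚ
  K = fromℕ (suc k)
  X : ℕ → ℚ
  X r = fromℕ r ^ m
  drop-zero : ∀ a x → a + 0ℚ * x ≡ a
  drop-zero = solve-∀ ℚ-ring
  regroup : ∀ u u′ X K → K * (u + u′) * X ≡ K * (u * X + u′ * X)
  regroup = solve-∀ ℚ-ring
  term : ∀ r → signedBinom (suc k) r * (fromℕ r * X r) ≡ K * (signedBinom (suc k) r * X r + signedBinom k r * X r)
  term r = begin
    signedBinom (suc k) r * (fromℕ r * X r)   ≡⟨ ℚ.*-assoc (signedBinom (suc k) r) (fromℕ r) (X r) ⟨
    signedBinom (suc k) r * fromℕ r * X r     ≡⟨ cong (_* X r) (signedBinom-absorb k r) ⟩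
    K * (signedBinom (suc k) r + signedBinom k r) * X r
      ≡⟨ regroup (signedBinom (suc k) r) (signedBinom k r) (X r) K ⟩
    K * (signedBinom (suc k) r * X r + signedBinom k r * X r) ∎

stirling2-explicit : ∀ m k → fromℕ (k ! ℕ.* stirling2 m k) ≡ alternatingPowerSum k m
stirling2-explicit zero    zero    = refl
stirling2-explicit zero    (suc k) =
  trans (cong fromℕ (ℕ.*-zeroʳ (suc k !))) (sym (alternatingPowerSum-zero k))
stirling2-explicit (suc m) zero    = sym (cong (signedBinom 0 0 *_) (ℚ.*-zeroˡ (fromℕ 0 ^ m)))
stirling2-explicit (suc m) (suc k) = begin
  fromℕ (suc k ! ℕ.* stirling2 (suc m) (suc k))
    ≡⟨ cong fromℕ (recurrence (suc k) (k !) (stirling2 m (suc k)) (stirling2 m k)) ⟩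
  fromℕ (suc k ℕ.* (S₁ ℕ.+ S₀))
    ≡⟨ fromℕ-* (suc k) (S₁ ℕ.+ S₀) ⟩
  K * fromℕ (S₁ ℕ.+ S₀)
    ≡⟨ cong (K *_) (fromℕ-+ S₁ S₀) ⟩
  K * (fromℕ S₁ + fromℕ S₀)
    ≡⟨ cong₂ (λ x y → K * (x + y)) (stirling2-explicit m (suc k)) (stirling2-explicit m k) ⟩
  K * (alternatingPowerSum (suc k) m + alternatingPowerSum k m)
    ≡⟨ alternatingPowerSum-suc k m ⟨
  alternatingPowerSum (suc k) (suc m) ∎
  where
  open ≡-Reasoning
  K : ℚ
  K = fromℕ (suc k)
  S₁ S₀ : ℕ
  S₁ = suc k ! ℕ.* stirling2 m (suc k)
  S₀ = k ! ℕ.* stirling2 m k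
  recurrence : ∀ K f s₁ s₀ →
               K ℕ.* f ℕ.* (K ℕ.* s₁ ℕ.+ s₀) ≡ K ℕ.* (K ℕ.* f ℕ.* s₁ ℕ.+ f ℕ.* s₀)
  recurrence = ℕ.solve-∀

m<k⇒stirling2≡0 : ∀ {m k} → m ℕ.< k → stirling2 m k ≡ 0
m<k⇒stirling2≡0 {zero}  {suc k} _         = refl
m<k⇒stirling2≡0 {suc m} {suc k} (s≤s m<k) =
  trans (cong₂ (λ x y → suc k ℕ.* x ℕ.+ y) (m<k⇒stirling2≡0 (ℕ.m<n⇒m<1+n m<k)) (m<k⇒stirling2≡0 m<k))
        (trans (ℕ.+-identityʳ (suc k ℕ.* 0)) (ℕ.*-zeroʳ (suc k)))

p-explicit : ∀ k n → p (suc n) (suc k) ≡ alternatingPowerSum k n * fracℕ 1 (suc k) ^ n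
p-explicit k n = begin
  fracℕ (d ! ℕ.* S) (d ℕ.^ suc n)           ≡⟨ cong (λ a → fracℕ a (d ℕ.^ suc n)) (ℕ.*-assoc d (k !) S) ⟩
  fracℕ (d ℕ.* (k ! ℕ.* S)) (d ℕ.* d ℕ.^ n) ≡⟨ fracℕ-cancelˡ d (k ! ℕ.* S) (d ℕ.^ n) ⟩
  fracℕ (k ! ℕ.* S) (d ℕ.^ n)               ≡⟨ fracℕ≡fromℕ*1/ (k ! ℕ.* S) (d ℕ.^ n) ⟩
  fromℕ (k ! ℕ.* S) * fracℕ 1 (d ℕ.^ n)     ≡⟨ cong₂ _*_ (stirling2-explicit n k) 1/dⁿ≡[1/d]ⁿ ⟩
  alternatingPowerSum k n * fracℕ 1 d ^ n   ∎
  where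
  open ≡-Reasoning
  instance _ = ℕ.m^n≢0 (suc k) n
  d S : ℕ
  d = suc k
  S = stirling2 n k
  1/dⁿ≡[1/d]ⁿ : fracℕ 1 (d ℕ.^ n) ≡ fracℕ 1 d ^ n
  1/dⁿ≡[1/d]ⁿ = sym (trans (fracℕ-^ 1 d n) (cong (λ a → fracℕ a (d ℕ.^ n)) (ℕ.^-zeroˡ n)))

alternatingPowerSum-scaled : ∀ k b n .{{_ : NonZero b}} →
  alternatingPowerSum k (suc n) * fracℕ 1 b ^ suc n ≡ sum1to k (λ r → signedBinom k r * fracℕ r b ^ suc n)
alternatingPowerSum-scaled k b n = begin
  alternatingPowerSum k N * z ^ N
    ≡⟨ ℚ.*-comm (alternatingPowerSum k N) (z ^ N) ⟩
  z ^ N * alternatingPowerSum k N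
    ≡⟨ *-distribˡ-sum0to _ (z ^ N) k ⟩
  sum0to k (λ r → z ^ N * (signedBinom k r * fromℕ r ^ N))
    ≡⟨ sum0to-cong k (λ r _ → term r) ⟩
  sum0to k (λ r → signedBinom k r * fracℕ r b ^ N)
    ≡⟨ sum0to≡f0+sum1to (λ r → signedBinom k r * fracℕ r b ^ N) k ⟩
  signedBinom k 0 * (fracℕ 0 b * fracℕ 0 b ^ n) + Σ₁
    ≡⟨ cong (λ x → signedBinom k 0 * (x * fracℕ 0 b ^ n) + Σ₁) (fracℕ-zero b) ⟩
  signedBinom k 0 * (0ℚ * fracℕ 0 b ^ n) + Σ₁
    ≡⟨ drop-zero (signedBinom k 0) (fracℕ 0 b ^ n) Σ₁ ⟩
  Σ₁ ∎
  where
  open ≡-Reasoning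
  N : ℕ
  N = suc n
  z Σ₁ : ℚ
  z = fracℕ 1 b
  Σ₁ = sum1to k (λ r → signedBinom k r * fracℕ r b ^ N)
  drop-zero : ∀ u x s → u * (0ℚ * x) + s ≡ s
  drop-zero = solve-∀ ℚ-ring
  regroup : ∀ Z u X → Z * (u * X) ≡ u * (X * Z)
  regroup = solve-∀ ℚ-ring
  term : ∀ r → z ^ N * (signedBinom k r * fromℕ r ^ N) ≡ signedBinom k r * fracℕ r b ^ N
  term r = begin
    z ^ N * (signedBinom k r * fromℕ r ^ N)   ≡⟨ regroup (z ^ N) (signedBinom k r) (fromℕ r ^ N) ⟩
    signedBinom k r * (fromℕ r ^ N * z ^ N)   ≡⟨ cong (signedBinom k r *_) (^-distrib-* (fromℕ r) z N) ⟨
    signedBinom k r * (fromℕ r * z) ^ N       ≡⟨ cong (λ x → signedBinom k r * x ^ N) (fracℕ≡fromℕ*1/ r b) ⟨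
    signedBinom k r * fracℕ r b ^ N           ∎

-- Here d = k + 1 ≥ 2: tail-step only holds from N = 1 on, because 0⁰ = 1.
module CouponCollector (k : ℕ) .{{_ : NonZero k}} where

  d : ℕ
  d = suc k

  y : ℕ → ℚ
  y r = fracℕ r d

  x : ℕ → ℕ → ℚ
  x r s = fracℕ (r ℕ.* s) (d ℕ.* d)

  summand : ℕ → ℕ → ℚ
  summand N r = signedBinom k r * y r ^ N

  geometricSum : ℕ → ℕ → ℚ
  geometricSum r s = inv (1ℚ - x r s)

  partialSum : ℕ → ℚ
  partialSum N = sum0to N (λ n → p n d * p n d)

  tail : ℕ → ℚ
  tail N = sum1to k (λ r → sum1to k (λ s → summand N r * summand N s * geometricSum r s))

  x≡y*y : ∀ r s → x r s ≡ y r * y s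
  x≡y*y r s = sym (fracℕ-* r d s d)

  x<1 : ∀ {r s} → r ℕ.≤ k → s ℕ.≤ k → x r s ℚ.< 1ℚ
  x<1 {r} {s} r≤k s≤k = fracℕ-*<* (r ℕ.* s) (d ℕ.* d) 1 1
    (subst₂ ℕ._<_ (sym (ℕ.*-identityʳ (r ℕ.* s))) (sym (ℕ.*-identityˡ (d ℕ.* d)))
      (ℕ.*-mono-< (s≤s r≤k) (s≤s s≤k)))

  p-expansion : ∀ n → p (suc (suc n)) d ≡ sum1to k (summand (suc n))
  p-expansion n = trans (p-explicit k (suc n)) (alternatingPowerSum-scaled k d n)

  p-vanishes : ∀ {n} → n ℕ.≤ k → p n d ≡ 0ℚ
  p-vanishes {zero}  _   = refl
  p-vanishes {suc m} m<k = begin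
    fracℕ (d ! ℕ.* stirling2 m k) (d ℕ.^ suc m)
      ≡⟨ cong (λ c → fracℕ (d ! ℕ.* c) (d ℕ.^ suc m)) (m<k⇒stirling2≡0 m<k) ⟩
    fracℕ (d ! ℕ.* 0) (d ℕ.^ suc m)
      ≡⟨ cong (λ c → fracℕ c (d ℕ.^ suc m)) (ℕ.*-zeroʳ (d !)) ⟩
    fracℕ 0 (d ℕ.^ suc m)
      ≡⟨ fracℕ-zero (d ℕ.^ suc m) ⟩
    0ℚ ∎
    where open ≡-Reasoning

  partialSum-vanishes : ∀ N → N ℕ.≤ k → partialSum N ≡ 0ℚ
  partialSum-vanishes zero    _   = refl
  partialSum-vanishes (suc N) N<k =
    cong₂ (λ a b → a + b * b) (partialSum-vanishes N (ℕ.<⇒≤ N<k)) (p-vanishes N<k)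

  tail-step : ∀ n → tail (suc n) ≡ p (suc (suc n)) d * p (suc (suc n)) d + tail (suc (suc n))
  tail-step n = begin
    tail N
      ≡⟨ sum1to-cong k (λ r r≤k → sum1to-cong k (λ s s≤k → term r≤k s≤k)) ⟩
    sum1to k (λ r → sum1to k (λ s → summand N r * summand N s + summand (suc N) r * summand (suc N) s * geometricSum r s))
      ≡⟨ sum1to-cong k (λ r _ → sum1to-distrib-+ k) ⟩
    sum1to k (λ r → sum1to k (λ s → summand N r * summand N s)
                    + sum1to k (λ s → summand (suc N) r * summand (suc N) s * geometricSum r s))
      ≡⟨ sum1to-distrib-+ k ⟩
    sum1to k (λ r → sum1to k (λ s → summand N r * summand N s)) + tail (suc N)
      ≡⟨ cong (_+ tail (suc N)) (sum1to-*-sum1to k k (summand N) (summand N)) ⟨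
    sum1to k (summand N) * sum1to k (summand N) + tail (suc N)
      ≡⟨ cong (λ a → a * a + tail (suc N)) (p-expansion n) ⟨
    p (suc N) d * p (suc N) d + tail (suc N) ∎
    where
    open ≡-Reasoning
    N : ℕ
    N = suc n
    regroup : ∀ a Y P b Z Q → a * (Y * P) * (b * (Z * Q)) ≡ a * P * (b * Q) * (Y * Z)
    regroup = solve-∀ ℚ-ring
    term : ∀ {r s} → r ℕ.≤ k → s ℕ.≤ k → summand N r * summand N s * geometricSum r s ≡
           summand N r * summand N s + summand (suc N) r * summand (suc N) s * geometricSum r s
    term {r} {s} r≤k s≤k = begin
      summand N r * summand N s * geometricSum r s
        ≡⟨ geometric-step ([1-x]*inv[1-x]≡1 (x<1 r≤k s≤k)) (summand N r * summand N s) ⟩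
      summand N r * summand N s + summand N r * summand N s * x r s * geometricSum r s
        ≡⟨ cong (λ z → summand N r * summand N s + summand N r * summand N s * z * geometricSum r s) (x≡y*y r s) ⟩
      summand N r * summand N s + summand N r * summand N s * (y r * y s) * geometricSum r s
        ≡⟨ cong (λ z → summand N r * summand N s + z * geometricSum r s)
                (regroup (signedBinom k r) (y r) (y r ^ N) (signedBinom k s) (y s) (y s ^ N)) ⟨
      summand N r * summand N s + summand (suc N) r * summand (suc N) s * geometricSum r s ∎

  A-rescaled : ∀ r → fracℕ (d !) (d ℕ.^ d) * A k r ≡ summand k r
  A-rescaled r = begin
    c * (neg1pow (k ∸ r) * fracℕ (r ℕ.^ k) (k !) * fromℕ (k C r))
      ≡⟨ regroup c (neg1pow (k ∸ r)) (fracℕ (r ℕ.^ k) (k !)) (fromℕ (k C r)) ⟩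
    signedBinom k r * (c * fracℕ (r ℕ.^ k) (k !))
      ≡⟨ cong (signedBinom k r *_) (fracℕ-* (d !) (d ℕ.^ d) (r ℕ.^ k) (k !)) ⟩
    signedBinom k r * fracℕ (d ! ℕ.* r ℕ.^ k) (d ℕ.^ d ℕ.* k !)
      ≡⟨ cong (signedBinom k r *_) (fracℕ-*≡* (d ! ℕ.* r ℕ.^ k) (d ℕ.^ d ℕ.* k !) (r ℕ.^ k) (d ℕ.^ k)
           (cross d (k !) (r ℕ.^ k) (d ℕ.^ k))) ⟩
    signedBinom k r * fracℕ (r ℕ.^ k) (d ℕ.^ k)
      ≡⟨ cong (signedBinom k r *_) (fracℕ-^ r d k) ⟨
    summand k r ∎
    where
    open ≡-Reasoning
    instance
      _ = ℕ.m^n≢0 d d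
      _ = k ℕ.!≢0
      _ = ℕ.m^n≢0 d k
      _ = ℕ.m*n≢0 (d ℕ.^ d) (k !)
    c : ℚ
    c = fracℕ (d !) (d ℕ.^ d)
    regroup : ∀ l σ f b → l * (σ * f * b) ≡ σ * b * (l * f)
    regroup = solve-∀ ℚ-ring
    cross : ∀ d f R D → d ℕ.* f ℕ.* R ℕ.* D ≡ R ℕ.* (d ℕ.* D ℕ.* f)
    cross = ℕ.solve-∀

  tail-k≡rhs : tail k ≡ rhs d
  tail-k≡rhs = sym (begin
    fracℕ (d ! ℕ.* d !) (d ℕ.^ (2 ℕ.* d)) * ΣA
      ≡⟨ cong (_* ΣA) c≡c₁*c₁ ⟩
    c₁ * c₁ * ΣA
      ≡⟨ *-distribˡ-sum1to _ (c₁ * c₁) k ⟩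
    sum1to k (λ r → c₁ * c₁ * sum1to k (λ s → A k r * A k s * geometricSum r s))
      ≡⟨ sum1to-cong k (λ r _ → *-distribˡ-sum1to _ (c₁ * c₁) k) ⟩
    sum1to k (λ r → sum1to k (λ s → c₁ * c₁ * (A k r * A k s * geometricSum r s)))
      ≡⟨ sum1to-cong k (λ r _ → sum1to-cong k (λ s _ → term r s)) ⟩
    tail k ∎)
    where
    open ≡-Reasoning
    instance _ = ℕ.m^n≢0 d d
    c₁ ΣA : ℚ
    c₁ = fracℕ (d !) (d ℕ.^ d)
    ΣA = sum1to k (λ r → sum1to k (λ s → A k r * A k s * geometricSum r s))
    d^[2d]≡d^d*d^d : d ℕ.^ (2 ℕ.* d) ≡ d ℕ.^ d ℕ.* d ℕ.^ d
    d^[2d]≡d^d*d^d =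
      trans (ℕ.^-distribˡ-+-* d d (d ℕ.+ 0)) (cong (λ e → d ℕ.^ d ℕ.* d ℕ.^ e) (ℕ.+-identityʳ d))
    c≡c₁*c₁ : fracℕ (d ! ℕ.* d !) (d ℕ.^ (2 ℕ.* d)) ≡ c₁ * c₁
    c≡c₁*c₁ = sym (trans (fracℕ-* (d !) (d ℕ.^ d) (d !) (d ℕ.^ d))
                         (cong (fracℕ (d ! ℕ.* d !)) (sym d^[2d]≡d^d*d^d)))
    regroup : ∀ l a b i → l * l * (a * b * i) ≡ l * a * (l * b) * i
    regroup = solve-∀ ℚ-ring
    term : ∀ r s → c₁ * c₁ * (A k r * A k s * geometricSum r s) ≡ summand k r * summand k s * geometricSum r s
    term r s = trans (regroup c₁ (A k r) (A k s) (geometricSum r s))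
      (cong₂ (λ a b → a * b * geometricSum r s) (A-rescaled r) (A-rescaled s))

  partialSum-rhs≡-tail : ∀ M → k ℕ.≤ M → partialSum M - rhs d ≡ - tail M
  partialSum-rhs≡-tail M k≤M = begin
    partialSum M - rhs d
      ≡⟨ cong (λ a → partialSum M - a) tail-k≡rhs ⟨
    partialSum M - tail k
      ≡⟨ cong (λ a → partialSum M - a) (ℚ.+-identityˡ (tail k)) ⟨
    partialSum M - (0ℚ + tail k)
      ≡⟨ cong (λ a → partialSum M - (a + tail k)) (partialSum-vanishes k ℕ.≤-refl) ⟨
    partialSum M - (partialSum k + tail k)
      ≡⟨ cong (λ a → partialSum M - a) (sum0to+tail-invariant step M k≤M) ⟨
    partialSum M - (partialSum M + tail M)
      ≡⟨ cancel (partialSum M) (tail M) ⟩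
    - tail M ∎
    where
    open ≡-Reasoning
    cancel : ∀ a b → a - (a + b) ≡ - b
    cancel = solve-∀ ℚ-ring
    step : ∀ N → k ℕ.≤ N → tail N ≡ p (suc N) d * p (suc N) d + tail (suc N)
    step (suc n) _   = tail-step n
    step zero    k≤0 = contradiction (ℕ.n≤0⇒n≡0 k≤0) (ℕ.≢-nonZero⁻¹ k)

  ratio : ℚ
  ratio = fracℕ k d

  coefficient : ℕ → ℕ → ℚ
  coefficient r s = signedBinom k r * signedBinom k s * geometricSum r s

  coefficientSum : ℚ
  coefficientSum = sum1to k (λ r → sum1to k (λ s → ∣ coefficient r s ∣))

  x≤ratio : ∀ {r s} → r ℕ.≤ k → s ℕ.≤ k → x r s ℚ.≤ ratio
  x≤ratio {r} {s} r≤k s≤k = fracℕ-*≤* (r ℕ.* s) (d ℕ.* d) k d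
    (ℕ.≤-trans (ℕ.*-monoˡ-≤ d (ℕ.*-mono-≤ r≤k (ℕ.m≤n⇒m≤1+n s≤k)))
               (ℕ.≤-reflexive (ℕ.*-assoc k d d)))

  tail-term-bound : ∀ N {r s} → r ℕ.≤ k → s ℕ.≤ k →
    ∣ summand N r * summand N s * geometricSum r s ∣ ℚ.≤ ∣ coefficient r s ∣ * ratio ^ N
  tail-term-bound N {r} {s} r≤k s≤k = begin
    ∣ summand N r * summand N s * geometricSum r s ∣
      ≡⟨ cong ∣_∣ (trans (cong (coefficient r s *_) (^-distrib-* (y r) (y s) N))
                          (regroup (signedBinom k r) (y r ^ N) (signedBinom k s) (y s ^ N) (geometricSum r s))) ⟨
    ∣ coefficient r s * (y r * y s) ^ N ∣
      ≡⟨ ℚ.∣p*q∣≡∣p∣*∣q∣ (coefficient r s) ((y r * y s) ^ N) ⟩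
    ∣ coefficient r s ∣ * ∣ (y r * y s) ^ N ∣
      ≡⟨ cong (∣ coefficient r s ∣ *_) (ℚ.0≤p⇒∣p∣≡p (^-nonNeg N 0≤y*y)) ⟩
    ∣ coefficient r s ∣ * (y r * y s) ^ N
      ≤⟨ ℚ.*-monoˡ-≤-nonNeg ∣ coefficient r s ∣ {{ℚ.nonNegative (ℚ.0≤∣p∣ (coefficient r s))}}
           (^-mono-≤ N 0≤y*y (subst (ℚ._≤ ratio) (x≡y*y r s) (x≤ratio r≤k s≤k))) ⟩
    ∣ coefficient r s ∣ * ratio ^ N ∎
    where
    open ℚ.≤-Reasoning
    0≤y*y : 0ℚ ℚ.≤ y r * y s
    0≤y*y = subst (0ℚ ℚ.≤_) (x≡y*y r s) (fracℕ-nonNeg (r ℕ.* s) (d ℕ.* d))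
    regroup : ∀ a P b Q i → a * b * i * (P * Q) ≡ a * P * (b * Q) * i
    regroup = solve-∀ ℚ-ring

  tail-bound : ∀ N → ∣ tail N ∣ ℚ.≤ coefficientSum * ratio ^ N
  tail-bound N = begin
    ∣ tail N ∣
      ≤⟨ ∣sum1to∣≤sum1to k (λ r r≤k → ∣sum1to∣≤sum1to k (λ s s≤k → tail-term-bound N r≤k s≤k)) ⟩
    sum1to k (λ r → sum1to k (λ s → ∣ coefficient r s ∣ * ratio ^ N))
      ≡⟨ sum1to-cong k (λ r _ → *-distribʳ-sum1to (λ s → ∣ coefficient r s ∣) (ratio ^ N) k) ⟨
    sum1to k (λ r → sum1to k (λ s → ∣ coefficient r s ∣) * ratio ^ N)
      ≡⟨ *-distribʳ-sum1to (λ r → sum1to k (λ s → ∣ coefficient r s ∣)) (ratio ^ N) k ⟨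
    coefficientSum * ratio ^ N ∎
    where open ℚ.≤-Reasoning

  distance-bound : ∀ M → k ℕ.≤ M → ∣ partialSum M - rhs d ∣ ℚ.≤ coefficientSum * ratio ^ M
  distance-bound M k≤M = begin
    ∣ partialSum M - rhs d ∣   ≡⟨ cong ∣_∣ (partialSum-rhs≡-tail M k≤M) ⟩
    ∣ - tail M ∣               ≡⟨ ℚ.∣-p∣≡∣p∣ (tail M) ⟩
    ∣ tail M ∣                 ≤⟨ tail-bound M ⟩
    coefficientSum * ratio ^ M ∎
    where open ℚ.≤-Reasoning

mainTheorem2 : (d : ℕ) → 2 ≤ d →
    ConvergesTo (λ N → sum0to N (λ n → p n d * p n d)) (rhs d)
mainTheorem2 (suc (suc k)) (s≤s (s≤s z≤n)) =
  convergesTo-geometric {partialSum} {rhs d} coefficientSum (suc k) (suc k) (suc k) ℕ.≤-refl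
    distance-bound
  where open CouponCollector (suc k)
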